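{- Let $r,l,u,d\ge 0$ be integers. Then $$F(r,l,u,d)\cdot(r+l)!\,(u+d)! = F(r,u,l,d)\cdot (r+u)!\,(l+d)!.$$ In particular, $F(r,l,u,d)$ is $(x+1)$-positive if and only if $F(r,u,l,d)$ is $(x+1)$-positive.
   Context: A shuffle of words $V$ and $H$ is a word obtained by interleaving their letters, preserving the order within each (distinct interleavings counted separately). The signed peak-count of a shuffle is the number of occurrences of $\uparrow$ immediately followed by $\leftarrow$ minus the number of occurrences of $\rightarrow$ immediately followed by $\downarrow$. For nonnegative integers $r,l,u,d$, $F(r,l,u,d)\in\mathbb{Z}[x]$ is the polynomial $\sum_\sigma x^{|\text{signed peak-count of }\sigma|}$, summed over all shuffles $\sigma$ of a word $V$ with $u$ letters $\uparrow$ and $d$ letters $\downarrow$ with a word $H$ with $r$ letters $\rightarrow$ and $l$ letters $\leftarrow$ (this polynomial does not depend on the order of the letters in $V$ and $H$). A polynomial in $\mathbb{Z}[x]$ is $(x+1)$-positive if it lies in $\mathbb{N}_0[x+1]$. -}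

module Defs where

open import Data.Nat using (ℕ; zero; suc; _+_; _*_; _!)
open import Data.Nat.Combinatorics using (_C_)
open import Data.Integer using (ℤ; +_; ∣_∣) renaming (_+_ to _+ℤ_; _-_ to _-ℤ_)
open import Data.List using (List; []; _∷_; map; _++_; replicate; length; filter)
open import Data.Product using (∃)
open import Relation.Binary.PropositionalEquality using (_≡_)
open import Relation.Nullary.Decidable using (does)
import Data.Nat as ℕ

data Letter : Set where
  up down right left : Letter

-- All shuffles (interleavings) of two words, distinct interleavings
-- listed separately (so the list may contain repeated words).
shuffles : List Letter → List Letter → List (List Letter)
shuffles []       ys       = ys ∷ []
shuffles (x ∷ xs) []       = (x ∷ xs) ∷ []
shuffles (x ∷ xs) (y ∷ ys) =
  map (x ∷_) (shuffles xs (y ∷ ys)) ++ map (y ∷_) (shuffles (x ∷ xs) ys)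

countUpLeft : List Letter → ℕ
countUpLeft (up ∷ left ∷ w) = suc (countUpLeft (left ∷ w))
countUpLeft (_ ∷ w)     = countUpLeft w
countUpLeft []          = 0

countRightDown : List Letter → ℕ
countRightDown (right ∷ down ∷ w) = suc (countRightDown (down ∷ w))
countRightDown (_ ∷ w)     = countRightDown w
countRightDown []          = 0

signedPeakCount : List Letter → ℤ
signedPeakCount w = + countUpLeft w -ℤ + countRightDown w

-- Polynomials in ℤ[x] are represented by their coefficient functions
-- (coefficient of x^k); equality of polynomials is pointwise equality.
Poly : Set
Poly = ℕ → ℤ

_·_ : Poly → ℤ → Poly
(p · c) k = p k Data.Integer.* c

-- Canonical words: V = ↑^u ↓^d, H = →^r ←^l  (F does not depend on order).
wordV : ℕ → ℕ → List Letter
wordV u d = replicate u up ++ replicate d down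

wordH : ℕ → ℕ → List Letter
wordH r l = replicate r right ++ replicate l left

-- F(r,l,u,d) = Σ_σ x^{|spc σ|}; its coefficient of x^k counts shuffles σ
-- with |signed peak-count σ| = k.
F : ℕ → ℕ → ℕ → ℕ → Poly
F r l u d k =
  + length (filter (λ σ → ∣ signedPeakCount σ ∣ ℕ.≟ k) (shuffles (wordV u d) (wordH r l)))

-- coefficient of x^k in Σ_j c_j (x+1)^(i+j), where c = c_0 ∷ c_1 ∷ …
shiftedCoeff : List ℕ → ℕ → ℕ → ℕ
shiftedCoeff []       i k = 0
shiftedCoeff (c ∷ cs) i k = c * (i C k) + shiftedCoeff cs (suc i) k

XPlus1Positive : Poly → Set
XPlus1Positive p = ∃ λ (c : List ℕ) → ∀ k → p k ≡ + shiftedCoeff c 0 k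

-- We compute the distribution of the signed peak count exactly: among the
-- shuffles of ↑^u ↓^d with →^r ←^l precisely  C(r+u, r+m) C(l+d, l-m)  have
-- signed peak count m (peakNumber).  The shuffles are enumerated by a recursion
-- on their first letter that remembers only the previous letter (peaksAfter);
-- the three states that matter (neutral, after ↑ facing ←'s, after → facing
-- ↓'s) have closed forms, and every branch of the recursion is Pascal's rule.
-- With a = r+m, b = u-m, c = l-m, e = d+m the closed form times (r+l)! (u+d)! is
-- C(a+b,a) C(c+e,c) (a+c)! (b+e)! = (a+b)! (c+e)! (a+c)! (b+e)! / (a! b! c! e!),
-- which is symmetric under b ↔ c, i.e. under l ↔ u.  As the coefficient of x^k
-- in F counts the shuffles with signed peak count k or -k, the identity follows.
-- For positivity: the coordinates of a polynomial in the basis (x+1)^i are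
-- obtained from its coefficients by a unitriangular integer change of basis, so
-- if f a = g b and f has natural coordinates c_i, then b divides every c_i a
-- and g has the natural coordinates c_i a / b.

module Submission where

open import Defs
open import Data.Nat using (ℕ; zero; suc; _+_; _*_; _!; _∸_; _<_; _≤_; _≤?_; s≤s; z≤n; NonZero)
import Data.Nat as ℕ
import Data.Nat.Properties as ℕP
open import Data.Nat.Combinatorics
  using (_C_; nCn≡1; k>n⇒nCk≡0; nCk≡n!/k![n-k]!; k![n∸k]!∣n!; nCk+nC[k+1]≡[n+1]C[k+1])
open import Data.Nat.Divisibility using (_∣_; divides; ∣m∣n⇒∣m+n; ∣m+n∣m⇒∣n; ∣m⇒∣m*n)
open import Data.Nat.DivMod using (_/_; m/n*n≡m)
import Data.Nat.Tactic.RingSolver as ℕSolver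
open import Data.Integer using (ℤ; +_; -[1+_]; ∣_∣; +<+)
  renaming (_+_ to _+ℤ_; _-_ to _-ℤ_; _<_ to _<ℤ_)
import Data.Integer as ℤ
import Data.Integer.Properties as ℤP
open import Data.Integer.Tactic.RingSolver using (solve-∀)
open import Data.List using (List; []; _∷_; map; _++_; length; filter)
open import Data.List.Properties using (filter-++; length-++; map-id)
open import Data.List.Relation.Unary.All using (All; []; _∷_)
open import Data.Bool using (true; false; if_then_else_)
open import Data.Product using (_×_; _,_)
open import Function using (id)
open import Function.Bundles using (_⇔_; mk⇔)
open import Level using (0ℓ)
open import Relation.Nullary using (Dec; does; yes; no)
open import Relation.Nullary.Decidable using (does-⇔)
open import Relation.Unary using (Pred; Decidable)
open import Relation.Binary.PropositionalEquality

open ≡-Reasoning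

-- Binomial coefficient with an integer lower index; it vanishes below zero,
-- which makes Pascal's rule hold without side conditions.
binom : ℕ → ℤ → ℕ
binom n (+ k)    = n C k
binom n -[1+ k ] = 0

binom-pascal : ∀ n j → binom (suc n) j ≡ binom n j + binom n (j -ℤ + 1)
binom-pascal n (+ zero)  = refl
binom-pascal n (+ suc k) = trans (sym (nCk+nC[k+1]≡[n+1]C[k+1] n k)) (ℕP.+-comm (n C k) _)
binom-pascal n -[1+ k ]  = refl

paths : ℤ → ℤ → ℕ
paths (+ a) (+ b) = (a + b) C a
paths _     _     = 0

paths-neg : ∀ a b → b <ℤ + 0 → paths a b ≡ 0
paths-neg (+ a) -[1+ b ] _ = refl
paths-neg -[1+ a ] b _ = refl
paths-neg (+ a) (+ b) (+<+ ())

binom≡paths : ∀ n j → binom n j ≡ paths j (+ n -ℤ j)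
binom≡paths n -[1+ k ] = refl
binom≡paths n (+ k) with k ≤? n
... | yes k≤n = begin
  n C k                 ≡⟨ cong (_C k) (sym (ℕP.m+[n∸m]≡n k≤n)) ⟩
  (k + (n ∸ k)) C k     ≡⟨ cong (paths (+ k)) (sym (trans (ℤP.m-n≡m⊖n n k) (ℤP.⊖-≥ k≤n))) ⟩
  paths (+ k) (+ n -ℤ + k) ∎
... | no k≰n = trans (k>n⇒nCk≡0 (ℕP.≰⇒> k≰n)) (sym (paths-neg (+ k) _ n-k<0))
  where
  n-k<0 : + n -ℤ + k <ℤ + 0
  n-k<0 = subst₂ _<ℤ_ (sym (ℤP.m-n≡m⊖n n k)) (ℤP.n⊖n≡0 n) (ℤP.⊖-monoʳ->-< n (ℕP.≰⇒> k≰n))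

binomial-factorial : ∀ a b → ((a + b) C a) * (a ! * b !) ≡ (a + b) !
binomial-factorial a b = begin
  ((a + b) C a) * (a ! * b !)                     ≡⟨ cong (λ x → ((a + b) C a) * (a ! * x !)) (sym (ℕP.m+n∸m≡n a b)) ⟩
  ((a + b) C a) * (a ! * (a + b ∸ a) !)           ≡⟨ cong (_* (a ! * (a + b ∸ a) !)) (nCk≡n!/k![n-k]! a≤a+b) ⟩
  (a + b) ! / (a ! * (a + b ∸ a) !) * (a ! * (a + b ∸ a) !) ≡⟨ m/n*n≡m (k![n∸k]!∣n! a≤a+b) ⟩
  (a + b) ! ∎
  where
  a≤a+b = ℕP.m≤m+n a b
  instance _ = ℕP._!*_!≢0 a (a + b ∸ a)

paths-times-factorials : ∀ a b c e →
  ((a + b) C a) * ((c + e) C c) * ((a + c) ! * (b + e) !) * ((a ! * b !) * (c ! * e !))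
    ≡ (a + b) ! * (c + e) ! * ((a + c) ! * (b + e) !)
paths-times-factorials a b c e = begin
  X * Y * W * ((a ! * b !) * (c ! * e !))    ≡⟨ regroup X Y W (a ! * b !) (c ! * e !) ⟩
  X * (a ! * b !) * (Y * (c ! * e !)) * W    ≡⟨ cong₂ (λ x y → x * y * W) (binomial-factorial a b) (binomial-factorial c e) ⟩
  (a + b) ! * (c + e) ! * W                  ∎
  where
  X = (a + b) C a
  Y = (c + e) C c
  W = (a + c) ! * (b + e) !
  regroup : ∀ x y f p q → x * y * f * (p * q) ≡ x * p * (y * q) * f
  regroup = ℕSolver.solve-∀

-- The heart of the identity: C(a+b,a) C(c+e,c) (a+c)! (b+e)! is symmetric in b and c,
-- since both sides equal (a+b)! (c+e)! (a+c)! (b+e)! / (a! b! c! e!).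
paths-symmetryℕ : ∀ a b c e →
  ((a + b) C a) * ((c + e) C c) * ((a + c) ! * (b + e) !)
    ≡ ((a + c) C a) * ((b + e) C b) * ((a + b) ! * (c + e) !)
paths-symmetryℕ a b c e = ℕP.*-cancelʳ-≡ _ _ ((a ! * b !) * (c ! * e !)) {{D≢0}} (begin
  ((a + b) C a) * ((c + e) C c) * ((a + c) ! * (b + e) !) * ((a ! * b !) * (c ! * e !))
    ≡⟨ paths-times-factorials a b c e ⟩
  (a + b) ! * (c + e) ! * ((a + c) ! * (b + e) !)
    ≡⟨ ℕP.*-comm ((a + b) ! * (c + e) !) _ ⟩
  (a + c) ! * (b + e) ! * ((a + b) ! * (c + e) !)
    ≡⟨ sym (paths-times-factorials a c b e) ⟩
  ((a + c) C a) * ((b + e) C b) * ((a + b) ! * (c + e) !) * ((a ! * c !) * (b ! * e !))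
    ≡⟨ cong (((a + c) C a) * ((b + e) C b) * ((a + b) ! * (c + e) !) *_) (middle-swap (a !) (c !) (b !) (e !)) ⟩
  ((a + c) C a) * ((b + e) C b) * ((a + b) ! * (c + e) !) * ((a ! * b !) * (c ! * e !)) ∎)
  where
  D≢0 : NonZero ((a ! * b !) * (c ! * e !))
  D≢0 = ℕP.m*n≢0 _ _ {{ℕP._!*_!≢0 a b}} {{ℕP._!*_!≢0 c e}}
  middle-swap : ∀ p q r s → (p * q) * (r * s) ≡ (p * r) * (q * s)
  middle-swap = ℕSolver.solve-∀

-- The same symmetry for integer step numbers: if any of them is negative both
-- sides vanish.  The factorial arguments are given as naturals equal to the
-- relevant sums.
paths-symmetry : ∀ a b c e {n₁ n₂ n₃ n₄ : ℕ} →
  + n₁ ≡ a +ℤ c → + n₂ ≡ b +ℤ e → + n₃ ≡ a +ℤ b → + n₄ ≡ c +ℤ e →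
  paths a b * paths c e * (n₁ ! * n₂ !) ≡ paths a c * paths b e * (n₃ ! * n₄ !)
paths-symmetry (+ a) (+ b) (+ c) (+ e) h₁ h₂ h₃ h₄
  rewrite ℤP.+-injective h₁ | ℤP.+-injective h₂ | ℤP.+-injective h₃ | ℤP.+-injective h₄
  = paths-symmetryℕ a b c e
paths-symmetry -[1+ a ] b c e _ _ _ _ = refl
paths-symmetry (+ a) -[1+ b ] c e {n₃ = n₃} {n₄} _ _ _ _ =
  sym (cong (_* (n₃ ! * n₄ !)) (ℕP.*-zeroʳ (paths (+ a) c)))
paths-symmetry (+ a) (+ b) -[1+ c ] e {n₁} {n₂} _ _ _ _ =
  cong (_* (n₁ ! * n₂ !)) (ℕP.*-zeroʳ (paths (+ a) (+ b)))
paths-symmetry (+ a) (+ b) (+ c) -[1+ e ] {n₁} {n₂} {n₃} {n₄} _ _ _ _ =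
  trans (cong (_* (n₁ ! * n₂ !)) (ℕP.*-zeroʳ (paths (+ a) (+ b))))
        (sym (cong (_* (n₃ ! * n₄ !)) (ℕP.*-zeroʳ (paths (+ a) (+ c)))))

-- The closed form of the number of shuffles of ↑^u ↓^d with →^r ←^l whose
-- signed peak count is m:  C(r+u, r+m) C(l+d, l-m).
peakNumber : ℕ → ℕ → ℕ → ℕ → ℤ → ℕ
peakNumber r l u d m = binom (r + u) (+ r +ℤ m) * binom (l + d) (+ l -ℤ m)

peakNumber≡paths : ∀ r l u d m →
  peakNumber r l u d m ≡ paths (+ r +ℤ m) (+ u -ℤ m) * paths (+ l -ℤ m) (+ d +ℤ m)
peakNumber≡paths r l u d m = cong₂ _*_
  (trans (binom≡paths (r + u) (+ r +ℤ m)) (cong (paths (+ r +ℤ m)) (sum-minus r u m)))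
  (trans (binom≡paths (l + d) (+ l -ℤ m)) (cong (paths (+ l -ℤ m)) (sum-minus-minus l d m)))
  where
  sum-minus : ∀ x y m → + (x + y) -ℤ (+ x +ℤ m) ≡ + y -ℤ m
  sum-minus x y m rewrite ℤP.pos-+ x y = ring (+ x) (+ y) m
    where
    ring : ∀ X Y M → (X +ℤ Y) -ℤ (X +ℤ M) ≡ Y -ℤ M
    ring = solve-∀
  sum-minus-minus : ∀ x y m → + (x + y) -ℤ (+ x -ℤ m) ≡ + y +ℤ m
  sum-minus-minus x y m rewrite ℤP.pos-+ x y = ring (+ x) (+ y) m
    where
    ring : ∀ X Y M → (X +ℤ Y) -ℤ (X -ℤ M) ≡ Y +ℤ M
    ring = solve-∀

sum-shift : ∀ x y m → + (x + y) ≡ (+ x +ℤ m) +ℤ (+ y -ℤ m)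
sum-shift x y m rewrite ℤP.pos-+ x y = ring (+ x) (+ y) m
  where
  ring : ∀ X Y M → X +ℤ Y ≡ (X +ℤ M) +ℤ (Y -ℤ M)
  ring = solve-∀

sum-shift′ : ∀ x y m → + (x + y) ≡ (+ x -ℤ m) +ℤ (+ y +ℤ m)
sum-shift′ x y m rewrite ℤP.pos-+ x y = ring (+ x) (+ y) m
  where
  ring : ∀ X Y M → X +ℤ Y ≡ (X -ℤ M) +ℤ (Y +ℤ M)
  ring = solve-∀

peakNumber-symmetry : ∀ r l u d m →
  peakNumber r l u d m * ((r + l) ! * (u + d) !) ≡ peakNumber r u l d m * ((r + u) ! * (l + d) !)
peakNumber-symmetry r l u d m = begin
  peakNumber r l u d m * ((r + l) ! * (u + d) !)
    ≡⟨ cong (_* ((r + l) ! * (u + d) !)) (peakNumber≡paths r l u d m) ⟩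
  paths a b * paths c e * ((r + l) ! * (u + d) !)
    ≡⟨ paths-symmetry a b c e (sum-shift r l m) (sum-shift′ u d m) (sum-shift r u m) (sum-shift′ l d m) ⟩
  paths a c * paths b e * ((r + u) ! * (l + d) !)
    ≡⟨ cong (_* ((r + u) ! * (l + d) !)) (sym (peakNumber≡paths r u l d m)) ⟩
  peakNumber r u l d m * ((r + u) ! * (l + d) !) ∎
  where
  a = + r +ℤ m
  b = + u -ℤ m
  c = + l -ℤ m
  e = + d +ℤ m

𝟙 : {P : Set} → Dec P → ℕ
𝟙 P? = if does P? then 1 else 0

length-filter-∷ : {A : Set} {P : Pred A 0ℓ} (P? : Decidable P) (a : A) (L : List A) →
  length (filter P? (a ∷ L)) ≡ 𝟙 (P? a) + length (filter P? L)
length-filter-∷ P? a L with does (P? a)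
... | true  = refl
... | false = refl

length-filter-map : {A B : Set} {P : Pred A 0ℓ} {Q : Pred B 0ℓ} (P? : Decidable P) (Q? : Decidable Q)
  (f : B → A) → (∀ b → P (f b) ⇔ Q b) → ∀ L → length (filter P? (map f L)) ≡ length (filter Q? L)
length-filter-map P? Q? f equiv [] = refl
length-filter-map P? Q? f equiv (b ∷ L) = begin
  length (filter P? (f b ∷ map f L))           ≡⟨ length-filter-∷ P? (f b) (map f L) ⟩
  𝟙 (P? (f b)) + length (filter P? (map f L))  ≡⟨ cong₂ _+_ same-indicator (length-filter-map P? Q? f equiv L) ⟩
  𝟙 (Q? b) + length (filter Q? L)              ≡⟨ sym (length-filter-∷ Q? b L) ⟩
  length (filter Q? (b ∷ L))                   ∎
  where
  same-indicator : 𝟙 (P? (f b)) ≡ 𝟙 (Q? b)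
  same-indicator = cong (λ t → if t then 1 else 0) (does-⇔ (equiv b) (P? (f b)) (Q? b))

length-filter-split : {A : Set} {P Q R : Pred A 0ℓ} (R? : Decidable R) (P? : Decidable P) (Q? : Decidable Q) →
  (∀ a → 𝟙 (R? a) ≡ 𝟙 (P? a) + 𝟙 (Q? a)) →
  ∀ L → length (filter R? L) ≡ length (filter P? L) + length (filter Q? L)
length-filter-split R? P? Q? split [] = refl
length-filter-split R? P? Q? split (a ∷ L) = begin
  length (filter R? (a ∷ L))
    ≡⟨ length-filter-∷ R? a L ⟩
  𝟙 (R? a) + length (filter R? L)
    ≡⟨ cong₂ _+_ (split a) (length-filter-split R? P? Q? split L) ⟩
  (𝟙 (P? a) + 𝟙 (Q? a)) + (length (filter P? L) + length (filter Q? L))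
    ≡⟨ interchange (𝟙 (P? a)) (𝟙 (Q? a)) _ _ ⟩
  (𝟙 (P? a) + length (filter P? L)) + (𝟙 (Q? a) + length (filter Q? L))
    ≡⟨ sym (cong₂ _+_ (length-filter-∷ P? a L) (length-filter-∷ Q? a L)) ⟩
  length (filter P? (a ∷ L)) + length (filter Q? (a ∷ L)) ∎
  where
  interchange : ∀ w x y z → (w + x) + (y + z) ≡ (w + y) + (x + z)
  interchange = ℕSolver.solve-∀

weight : Letter → Letter → ℤ
weight up    left = + 1
weight right down = -[1+ 0 ]
weight _     _    = + 0

peakCount-∷ : ∀ p x τ → signedPeakCount (p ∷ x ∷ τ) ≡ weight p x +ℤ signedPeakCount (x ∷ τ)
peakCount-∷ up left τ =
  ℤP.+-assoc (+ 1) (+ countUpLeft (left ∷ τ)) (ℤ.- + countRightDown (left ∷ τ))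
peakCount-∷ right down τ = ring (+ countUpLeft (down ∷ τ)) (+ countRightDown (down ∷ τ))
  where
  ring : ∀ a b → a -ℤ (+ 1 +ℤ b) ≡ ℤ.- + 1 +ℤ (a -ℤ b)
  ring = solve-∀
peakCount-∷ up    up    τ = sym (ℤP.+-identityˡ _)
peakCount-∷ up    down  τ = sym (ℤP.+-identityˡ _)
peakCount-∷ up    right τ = sym (ℤP.+-identityˡ _)
peakCount-∷ right up    τ = sym (ℤP.+-identityˡ _)
peakCount-∷ right right τ = sym (ℤP.+-identityˡ _)
peakCount-∷ right left  τ = sym (ℤP.+-identityˡ _)
peakCount-∷ down  x     τ = sym (ℤP.+-identityˡ _)
peakCount-∷ left  x     τ = sym (ℤP.+-identityˡ _)

peakCount-[] : ∀ p → signedPeakCount (p ∷ []) ≡ + 0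
peakCount-[] up    = refl
peakCount-[] down  = refl
peakCount-[] right = refl
peakCount-[] left  = refl

-- The signed peak count that x ∷ τ must have for p ∷ x ∷ τ to have count m.
-- It is  m - weight p x, written by cases so that it is literally m for
-- neutral pairs.
shift : Letter → Letter → ℤ → ℤ
shift up    left m = m -ℤ + 1
shift right down m = m +ℤ + 1
shift _     _    m = m

shift≡ : ∀ p x m → shift p x m ≡ m -ℤ weight p x
shift≡ up    left  m = refl
shift≡ right down  m = refl
shift≡ up    up    m = sym (ℤP.+-identityʳ m)
shift≡ up    down  m = sym (ℤP.+-identityʳ m)
shift≡ up    right m = sym (ℤP.+-identityʳ m)
shift≡ right up    m = sym (ℤP.+-identityʳ m)
shift≡ right right m = sym (ℤP.+-identityʳ m)
shift≡ right left  m = sym (ℤP.+-identityʳ m)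
shift≡ down  x     m = sym (ℤP.+-identityʳ m)
shift≡ left  x     m = sym (ℤP.+-identityʳ m)

peakCount-shift : ∀ p x τ m →
  signedPeakCount (p ∷ x ∷ τ) ≡ m ⇔ signedPeakCount (x ∷ τ) ≡ shift p x m
peakCount-shift p x τ m = mk⇔
  (λ eq → trans (solve-off w s) (trans (cong (_-ℤ w) (trans (sym (peakCount-∷ p x τ)) eq)) (sym (shift≡ p x m))))
  (λ eq → trans (peakCount-∷ p x τ) (trans (cong (w +ℤ_) (trans eq (shift≡ p x m))) (solve-on w m)))
  where
  w = weight p x
  s = signedPeakCount (x ∷ τ)
  solve-off : ∀ a b → b ≡ (a +ℤ b) -ℤ a
  solve-off = solve-∀
  solve-on : ∀ a b → a +ℤ (b -ℤ a) ≡ b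
  solve-on = solve-∀

countAfter : Letter → ℤ → List (List Letter) → ℕ
countAfter p m L = length (filter (λ σ → signedPeakCount (p ∷ σ) ℤ.≟ m) L)

countAfter-++ : ∀ p m L L′ → countAfter p m (L ++ L′) ≡ countAfter p m L + countAfter p m L′
countAfter-++ p m L L′ =
  trans (cong length (filter-++ P? L L′)) (length-++ (filter P? L))
  where P? = λ σ → signedPeakCount (p ∷ σ) ℤ.≟ m

countAfter-map : ∀ p x m L → countAfter p m (map (x ∷_) L) ≡ countAfter x (shift p x m) L
countAfter-map p x m = length-filter-map _ _ (x ∷_) (λ τ → peakCount-shift p x τ m)

δ₀ : ℤ → ℕ
δ₀ (+ zero) = 1
δ₀ _        = 0

peaksAfter : Letter → List Letter → List Letter → ℤ → ℕ
peaksAfter p []       []       m = δ₀ m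
peaksAfter p (x ∷ xs) []       m = peaksAfter x xs [] (shift p x m)
peaksAfter p []       (y ∷ ys) m = peaksAfter y [] ys (shift p y m)
peaksAfter p (x ∷ xs) (y ∷ ys) m =
  peaksAfter x xs (y ∷ ys) (shift p x m) + peaksAfter y (x ∷ xs) ys (shift p y m)

shuffles-[]ʳ : ∀ xs → shuffles xs [] ≡ xs ∷ []
shuffles-[]ʳ []       = refl
shuffles-[]ʳ (x ∷ xs) = refl

peaksAfter-correct : ∀ p xs ys m → peaksAfter p xs ys m ≡ countAfter p m (shuffles xs ys)
peaksAfter-correct p [] [] m = begin
  δ₀ m                                       ≡⟨ singleton m ⟩
  𝟙 (+ 0 ℤ.≟ m)                              ≡⟨ cong (λ s → 𝟙 (s ℤ.≟ m)) (sym (peakCount-[] p)) ⟩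
  𝟙 (signedPeakCount (p ∷ []) ℤ.≟ m)         ≡⟨ sym (ℕP.+-identityʳ _) ⟩
  𝟙 (signedPeakCount (p ∷ []) ℤ.≟ m) + 0     ≡⟨ sym (length-filter-∷ (λ σ → signedPeakCount (p ∷ σ) ℤ.≟ m) [] []) ⟩
  countAfter p m ([] ∷ [])                   ∎
  where
  singleton : ∀ m → δ₀ m ≡ 𝟙 (+ 0 ℤ.≟ m)
  singleton (+ zero)  = refl
  singleton (+ suc k) = refl
  singleton -[1+ k ]  = refl
peaksAfter-correct p (x ∷ xs) [] m = begin
  peaksAfter x xs [] (shift p x m)                 ≡⟨ peaksAfter-correct x xs [] _ ⟩
  countAfter x (shift p x m) (shuffles xs [])      ≡⟨ cong (countAfter x (shift p x m)) (shuffles-[]ʳ xs) ⟩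
  countAfter x (shift p x m) (xs ∷ [])             ≡⟨ sym (countAfter-map p x m (xs ∷ [])) ⟩
  countAfter p m ((x ∷ xs) ∷ [])                   ∎
peaksAfter-correct p [] (y ∷ ys) m =
  trans (peaksAfter-correct y [] ys _) (sym (countAfter-map p y m (ys ∷ [])))
peaksAfter-correct p (x ∷ xs) (y ∷ ys) m = begin
  peaksAfter x xs (y ∷ ys) (shift p x m) + peaksAfter y (x ∷ xs) ys (shift p y m)
    ≡⟨ cong₂ _+_ (trans (peaksAfter-correct x xs (y ∷ ys) _) (sym (countAfter-map p x m (shuffles xs (y ∷ ys)))))
                 (trans (peaksAfter-correct y (x ∷ xs) ys _) (sym (countAfter-map p y m (shuffles (x ∷ xs) ys)))) ⟩
  countAfter p m (map (x ∷_) (shuffles xs (y ∷ ys))) + countAfter p m (map (y ∷_) (shuffles (x ∷ xs) ys))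
    ≡⟨ sym (countAfter-++ p m (map (x ∷_) (shuffles xs (y ∷ ys))) (map (y ∷_) (shuffles (x ∷ xs) ys))) ⟩
  countAfter p m (shuffles (x ∷ xs) (y ∷ ys)) ∎

pascalʳ : ∀ n j {X X₁ X₂ a b i k} → X₁ ≡ X → X₂ ≡ X → a ≡ n → b ≡ n → i ≡ j → k ≡ j -ℤ + 1 →
  X₁ * binom a i + X₂ * binom b k ≡ X * binom (suc n) j
pascalʳ n j {X} refl refl refl refl refl refl =
  trans (sym (ℕP.*-distribˡ-+ X (binom n j) _)) (cong (X *_) (sym (binom-pascal n j)))

pascalˡ : ∀ n j {X X₁ X₂ a b i k} → X₁ ≡ X → X₂ ≡ X → a ≡ n → b ≡ n → i ≡ j → k ≡ j -ℤ + 1 →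
  binom a i * X₁ + binom b k * X₂ ≡ binom (suc n) j * X
pascalˡ n j {X} refl refl refl refl refl refl =
  trans (sym (ℕP.*-distribʳ-+ X (binom n j) _)) (cong (_* X) (sym (binom-pascal n j)))

-- Index bookkeeping for the Pascal steps (note that + suc n is + 1 +ℤ + n).
plus-pred : ∀ R M → R +ℤ M ≡ ((+ 1 +ℤ R) +ℤ M) -ℤ + 1
plus-pred = solve-∀

minus-pred : ∀ L M → L -ℤ M ≡ ((+ 1 +ℤ L) -ℤ M) -ℤ + 1
minus-pred = solve-∀

minus-of-pred : ∀ L M → L -ℤ (M -ℤ + 1) ≡ (+ 1 +ℤ L) -ℤ M
minus-of-pred = solve-∀

minus-of-suc : ∀ L M → L -ℤ (M +ℤ + 1) ≡ (L -ℤ M) -ℤ + 1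
minus-of-suc = solve-∀

plus-of-suc : ∀ R M → R +ℤ (M +ℤ + 1) ≡ (+ 1 +ℤ R) +ℤ M
plus-of-suc = solve-∀

suc-minus-of-suc : ∀ L M → (+ 1 +ℤ L) -ℤ (M +ℤ + 1) ≡ L -ℤ M
suc-minus-of-suc = solve-∀

afterUpNumber : ℕ → ℕ → ℕ → ℤ → ℕ
afterUpNumber zero    u d m = δ₀ m
afterUpNumber (suc l) u d m = binom (suc u) m * binom (l + d) (+ l -ℤ (m -ℤ + 1))

afterRightNumber : ℕ → ℕ → ℕ → ℤ → ℕ
afterRightNumber r l zero    m = δ₀ m
afterRightNumber r l (suc d) m = binom (suc r) (+ suc r +ℤ m) * binom (l + d) (+ l -ℤ (m +ℤ + 1))

-- The recurrences satisfied by the closed forms, one for each way the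
-- recursion of peaksAfter can branch; each is named after the state and the
-- two possible first letters, and each is an instance of Pascal's rule.
neutral-↑→ : ∀ r l u d m →
  peakNumber (suc r) l u d m + peakNumber r l (suc u) d m ≡ peakNumber (suc r) l (suc u) d m
neutral-↑→ r l u d m =
  pascalˡ (r + suc u) (+ suc r +ℤ m) refl refl (sym (ℕP.+-suc r u)) refl refl (plus-pred (+ r) m)

neutral-↑← : ∀ l u d m →
  afterUpNumber (suc l) u d m + peakNumber 0 l (suc u) d m ≡ peakNumber 0 (suc l) (suc u) d m
neutral-↑← l u d m =
  pascalʳ (l + d) (+ suc l -ℤ m) (cong (binom (suc u)) (sym (ℤP.+-identityˡ m))) refl refl refl
          (minus-of-pred (+ l) m) (minus-pred (+ l) m)

neutral-↓→ : ∀ r l d m →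
  peakNumber (suc r) l 0 d m + afterRightNumber r l (suc d) m ≡ peakNumber (suc r) l 0 (suc d) m
neutral-↓→ r l d m = trans
  (pascalʳ (l + d) (+ l -ℤ m) refl (cong (λ n → binom n (+ suc r +ℤ m)) (sym (ℕP.+-identityʳ (suc r))))
           refl refl refl (minus-of-suc (+ l) m))
  (cong (λ n → binom (suc r + 0) (+ suc r +ℤ m) * binom n (+ l -ℤ m)) (sym (ℕP.+-suc l d)))

neutral-↓← : ∀ l d m →
  peakNumber 0 (suc l) 0 d m + peakNumber 0 l 0 (suc d) m ≡ peakNumber 0 (suc l) 0 (suc d) m
neutral-↓← l d m =
  pascalʳ (l + suc d) (+ suc l -ℤ m) {X = binom 0 (+ 0 +ℤ m)} refl refl (sym (ℕP.+-suc l d)) refl refl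
          (minus-pred (+ l) m)

afterUp-↑← : ∀ l u d m →
  afterUpNumber (suc l) u d m + peakNumber 0 l (suc u) d (m -ℤ + 1) ≡ afterUpNumber (suc l) (suc u) d m
afterUp-↑← l u d m = pascalˡ (suc u) m refl refl refl refl refl (ℤP.+-identityˡ (m -ℤ + 1))

afterUp-↓← : ∀ l d m →
  peakNumber 0 (suc l) 0 d m + peakNumber 0 l 0 (suc d) (m -ℤ + 1) ≡ afterUpNumber (suc l) 0 (suc d) m
afterUp-↓← l d m =
  pascalˡ 0 m (cong₂ binom (sym (ℕP.+-suc l d)) (sym (minus-of-pred (+ l) m))) refl refl refl
          (ℤP.+-identityˡ m) (ℤP.+-identityˡ (m -ℤ + 1))

afterRight-↓→ : ∀ r l d m →
  peakNumber (suc r) l 0 d (m +ℤ + 1) + afterRightNumber r l (suc d) m ≡ afterRightNumber (suc r) l (suc d) m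
afterRight-↓→ r l d m =
  pascalˡ (suc r) (+ suc (suc r) +ℤ m) refl refl (ℕP.+-identityʳ (suc r)) refl
          (plus-of-suc (+ suc r) m) (plus-pred (+ suc r) m)

afterRight-↓← : ∀ l d m →
  peakNumber 0 (suc l) 0 d (m +ℤ + 1) + peakNumber 0 l 0 (suc d) m ≡ afterRightNumber 0 (suc l) (suc d) m
afterRight-↓← l d m =
  pascalˡ 0 (+ 1 +ℤ m) refl (cong₂ binom (ℕP.+-suc l d) (sym (suc-minus-of-suc (+ l) m))) refl refl
          (plus-of-suc (+ 0) m) (plus-pred (+ 0) m)

peakNumber-noHorizontal : ∀ u d m → peakNumber 0 0 u d m ≡ δ₀ m
peakNumber-noHorizontal u d (+ zero)  = refl
peakNumber-noHorizontal u d (+ suc k) = ℕP.*-zeroʳ (u C suc k)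
peakNumber-noHorizontal u d -[1+ k ]  = refl

peakNumber-noVertical : ∀ r l m → peakNumber r l 0 0 m ≡ δ₀ m
peakNumber-noVertical r l (+ zero)  = cong₂ _*_ (nCn≡1 (r + 0)) (nCn≡1 (l + 0))
peakNumber-noVertical r l (+ suc k) =
  cong (_* binom (l + 0) (+ l -ℤ + suc k)) (k>n⇒nCk≡0 (ℕP.+-monoʳ-< r (s≤s z≤n)))
peakNumber-noVertical r l -[1+ k ]  =
  trans (cong (binom (r + 0) (+ r +ℤ -[1+ k ]) *_) (k>n⇒nCk≡0 (ℕP.+-monoʳ-< l (s≤s z≤n))))
        (ℕP.*-zeroʳ (binom (r + 0) (+ r +ℤ -[1+ k ])))

-- After ↑ with only ←^(l+1) left there is exactly one peak ↑←.
afterUp-boundary : ∀ l m → δ₀ (m -ℤ + 1) ≡ afterUpNumber (suc l) 0 0 m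
afterUp-boundary l (+ zero)        =
  sym (trans (ℕP.*-identityˡ _) (k>n⇒nCk≡0 (ℕP.+-monoʳ-< l {0} {1} (s≤s z≤n))))
afterUp-boundary l (+ suc zero)    = sym (trans (ℕP.+-identityʳ _) (nCn≡1 (l + 0)))
afterUp-boundary l (+ suc (suc k)) = refl
afterUp-boundary l -[1+ k ]        = refl

-- After → with only ↓^(d+1) left there is exactly one peak →↓.
afterRight-boundary : ∀ d m → δ₀ (m +ℤ + 1) ≡ afterRightNumber 0 0 (suc d) m
afterRight-boundary d (+ zero)           = refl
afterRight-boundary d (+ suc k)          = refl
afterRight-boundary d -[1+ zero ]        = refl
afterRight-boundary d -[1+ suc k ]       = refl

-- A letter that cannot start a peak with the next letter behaves like the
-- neutral letter ↓.
up-before-right : ∀ u d H m →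
  peaksAfter up (wordV u d) (right ∷ H) m ≡ peaksAfter down (wordV u d) (right ∷ H) m
up-before-right (suc u) d       H m = refl
up-before-right zero    (suc d) H m = refl
up-before-right zero    zero    H m = refl

right-before-up : ∀ V r l m →
  peaksAfter right (up ∷ V) (wordH r l) m ≡ peaksAfter down (up ∷ V) (wordH r l) m
right-before-up V (suc r) l       m = refl
right-before-up V zero    (suc l) m = refl
right-before-up V zero    zero    m = refl

left-neutral : ∀ V H m → peaksAfter left V H m ≡ peaksAfter down V H m
left-neutral []      []      m = refl
left-neutral (x ∷ V) []      m = refl
left-neutral []      (y ∷ H) m = refl
left-neutral (x ∷ V) (y ∷ H) m = refl

onlyVertical-up   : ∀ u d m → peaksAfter up   (wordV u d) [] m ≡ δ₀ m
onlyVertical-down : ∀ u d m → peaksAfter down (wordV u d) [] m ≡ δ₀ m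
onlyVertical-up   (suc u) d       m = onlyVertical-up u d m
onlyVertical-up   zero    (suc d) m = onlyVertical-down zero d m
onlyVertical-up   zero    zero    m = refl
onlyVertical-down (suc u) d       m = onlyVertical-up u d m
onlyVertical-down zero    (suc d) m = onlyVertical-down zero d m
onlyVertical-down zero    zero    m = refl

onlyHorizontal-left : ∀ l m → peaksAfter left [] (wordH 0 l) m ≡ δ₀ m
onlyHorizontal-left zero    m = refl
onlyHorizontal-left (suc l) m = onlyHorizontal-left l m

onlyHorizontal-right : ∀ r l m → peaksAfter right [] (wordH r l) m ≡ δ₀ m
onlyHorizontal-right (suc r) l       m = onlyHorizontal-right r l m
onlyHorizontal-right zero    (suc l) m = onlyHorizontal-left l m
onlyHorizontal-right zero    zero    m = refl

combine : ∀ {a b a′ b′ c : ℕ} → a ≡ a′ → b ≡ b′ → a′ + b′ ≡ c → a + b ≡ c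
combine p q r = trans (cong₂ _+_ p q) r

peaks-neutral    : ∀ r l u d m → peaksAfter down (wordV u d) (wordH r l) m ≡ peakNumber r l u d m
peaks-afterUp    : ∀ l u d m → peaksAfter up (wordV u d) (wordH 0 l) m ≡ afterUpNumber l u d m
peaks-afterRight : ∀ r l d m → peaksAfter right (wordV 0 d) (wordH r l) m ≡ afterRightNumber r l d m

peaks-neutral (suc r) l (suc u) d m = combine
  (trans (up-before-right u d (wordH r l) m) (peaks-neutral (suc r) l u d m))
  (trans (right-before-up (wordV u d) r l m) (peaks-neutral r l (suc u) d m))
  (neutral-↑→ r l u d m)
peaks-neutral zero (suc l) (suc u) d m = combine
  (peaks-afterUp (suc l) u d m)
  (trans (left-neutral (wordV (suc u) d) (wordH 0 l) m) (peaks-neutral 0 l (suc u) d m))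
  (neutral-↑← l u d m)
peaks-neutral (suc r) l zero (suc d) m = combine
  (peaks-neutral (suc r) l 0 d m)
  (peaks-afterRight r l (suc d) m)
  (neutral-↓→ r l d m)
peaks-neutral zero (suc l) zero (suc d) m = combine
  (peaks-neutral 0 (suc l) 0 d m)
  (trans (left-neutral (wordV 0 (suc d)) (wordH 0 l) m) (peaks-neutral 0 l 0 (suc d) m))
  (neutral-↓← l d m)
peaks-neutral zero zero (suc u) d m = trans (onlyVertical-up u d m) (sym (peakNumber-noHorizontal (suc u) d m))
peaks-neutral zero zero zero d m = trans (onlyVertical-down 0 d m) (sym (peakNumber-noHorizontal 0 d m))
peaks-neutral (suc r) l zero zero m = trans (onlyHorizontal-right r l m) (sym (peakNumber-noVertical (suc r) l m))
peaks-neutral zero (suc l) zero zero m = trans (onlyHorizontal-left l m) (sym (peakNumber-noVertical 0 (suc l) m))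

peaks-afterUp zero u d m = onlyVertical-up u d m
peaks-afterUp (suc l) (suc u) d m = combine
  (peaks-afterUp (suc l) u d m)
  (trans (left-neutral (wordV (suc u) d) (wordH 0 l) _) (peaks-neutral 0 l (suc u) d (m -ℤ + 1)))
  (afterUp-↑← l u d m)
peaks-afterUp (suc l) zero (suc d) m = combine
  (peaks-neutral 0 (suc l) 0 d m)
  (trans (left-neutral (wordV 0 (suc d)) (wordH 0 l) _) (peaks-neutral 0 l 0 (suc d) (m -ℤ + 1)))
  (afterUp-↓← l d m)
peaks-afterUp (suc l) zero zero m = trans (onlyHorizontal-left l (m -ℤ + 1)) (afterUp-boundary l m)

peaks-afterRight r l zero m = onlyHorizontal-right r l m
peaks-afterRight (suc r) l (suc d) m = combine
  (peaks-neutral (suc r) l 0 d (m +ℤ + 1))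
  (peaks-afterRight r l (suc d) m)
  (afterRight-↓→ r l d m)
peaks-afterRight zero (suc l) (suc d) m = combine
  (peaks-neutral 0 (suc l) 0 d (m +ℤ + 1))
  (trans (left-neutral (wordV 0 (suc d)) (wordH 0 l) m) (peaks-neutral 0 l 0 (suc d) m))
  (afterRight-↓← l d m)
peaks-afterRight zero zero (suc d) m = trans (onlyVertical-down 0 d (m +ℤ + 1)) (afterRight-boundary d m)

count-abs-zero : {A : Set} (s : A → ℤ) (L : List A) →
  length (filter (λ a → ∣ s a ∣ ℕ.≟ 0) L) ≡ length (filter (λ a → s a ℤ.≟ + 0) L)
count-abs-zero s L = trans (cong (λ L′ → length (filter (λ a → ∣ s a ∣ ℕ.≟ 0) L′)) (sym (map-id L)))
  (length-filter-map _ _ id (λ a → mk⇔ ℤP.∣i∣≡0⇒i≡0 (cong ∣_∣)) L)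

count-abs-suc : {A : Set} (s : A → ℤ) (k : ℕ) (L : List A) →
  length (filter (λ a → ∣ s a ∣ ℕ.≟ suc k) L)
    ≡ length (filter (λ a → s a ℤ.≟ + suc k) L) + length (filter (λ a → s a ℤ.≟ -[1+ k ]) L)
count-abs-suc s k = length-filter-split _ _ _ (λ a → two-preimages (s a))
  where
  two-preimages : ∀ z → 𝟙 (∣ z ∣ ℕ.≟ suc k) ≡ 𝟙 (z ℤ.≟ + suc k) + 𝟙 (z ℤ.≟ -[1+ k ])
  two-preimages (+ n)    = sym (ℕP.+-identityʳ _)
  two-preimages -[1+ n ] = refl

coeffF : ℕ → ℕ → ℕ → ℕ → ℕ → ℕ
coeffF r l u d k = length (filter (λ σ → ∣ signedPeakCount σ ∣ ℕ.≟ k) (shuffles (wordV u d) (wordH r l)))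

shuffleCount : ∀ r l u d m →
  length (filter (λ σ → signedPeakCount σ ℤ.≟ m) (shuffles (wordV u d) (wordH r l))) ≡ peakNumber r l u d m
shuffleCount r l u d m =
  trans (sym (peaksAfter-correct down (wordV u d) (wordH r l) m)) (peaks-neutral r l u d m)

coeffF-zero : ∀ r l u d → coeffF r l u d 0 ≡ peakNumber r l u d (+ 0)
coeffF-zero r l u d =
  trans (count-abs-zero signedPeakCount (shuffles (wordV u d) (wordH r l))) (shuffleCount r l u d (+ 0))

coeffF-suc : ∀ r l u d k → coeffF r l u d (suc k) ≡ peakNumber r l u d (+ suc k) + peakNumber r l u d -[1+ k ]
coeffF-suc r l u d k =
  trans (count-abs-suc signedPeakCount k (shuffles (wordV u d) (wordH r l)))
        (cong₂ _+_ (shuffleCount r l u d (+ suc k)) (shuffleCount r l u d -[1+ k ]))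

coeffF-symmetry : ∀ r l u d k →
  coeffF r l u d k * ((r + l) ! * (u + d) !) ≡ coeffF r u l d k * ((r + u) ! * (l + d) !)
coeffF-symmetry r l u d zero = begin
  coeffF r l u d 0 * A               ≡⟨ cong (_* A) (coeffF-zero r l u d) ⟩
  peakNumber r l u d (+ 0) * A       ≡⟨ peakNumber-symmetry r l u d (+ 0) ⟩
  peakNumber r u l d (+ 0) * B       ≡⟨ cong (_* B) (sym (coeffF-zero r u l d)) ⟩
  coeffF r u l d 0 * B               ∎
  where
  A = (r + l) ! * (u + d) !
  B = (r + u) ! * (l + d) !
coeffF-symmetry r l u d (suc k) = begin
  coeffF r l u d (suc k) * A
    ≡⟨ cong (_* A) (coeffF-suc r l u d k) ⟩
  (peakNumber r l u d (+ suc k) + peakNumber r l u d -[1+ k ]) * A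
    ≡⟨ ℕP.*-distribʳ-+ A (peakNumber r l u d (+ suc k)) _ ⟩
  peakNumber r l u d (+ suc k) * A + peakNumber r l u d -[1+ k ] * A
    ≡⟨ cong₂ _+_ (peakNumber-symmetry r l u d (+ suc k)) (peakNumber-symmetry r l u d -[1+ k ]) ⟩
  peakNumber r u l d (+ suc k) * B + peakNumber r u l d -[1+ k ] * B
    ≡⟨ ℕP.*-distribʳ-+ B (peakNumber r u l d (+ suc k)) _ ⟨
  (peakNumber r u l d (+ suc k) + peakNumber r u l d -[1+ k ]) * B
    ≡⟨ cong (_* B) (coeffF-suc r u l d k) ⟨
  coeffF r u l d (suc k) * B ∎
  where
  A = (r + l) ! * (u + d) !
  B = (r + u) ! * (l + d) !

shiftedCoeff-scale : ∀ a cs i k → shiftedCoeff (map (_* a) cs) i k ≡ shiftedCoeff cs i k * a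
shiftedCoeff-scale a []       i k = refl
shiftedCoeff-scale a (c ∷ cs) i k = begin
  c * a * (i C k) + shiftedCoeff (map (_* a) cs) (suc i) k
    ≡⟨ cong (λ s → c * a * (i C k) + s) (shiftedCoeff-scale a cs (suc i) k) ⟩
  c * a * (i C k) + shiftedCoeff cs (suc i) k * a
    ≡⟨ factor c a (i C k) _ ⟩
  (c * (i C k) + shiftedCoeff cs (suc i) k) * a ∎
  where
  factor : ∀ c a b s → c * a * b + s * a ≡ (c * b + s) * a
  factor = ℕSolver.solve-∀

shiftedCoeff-∣ : ∀ {b} cs i k → All (b ∣_) cs → b ∣ shiftedCoeff cs i k
shiftedCoeff-∣ []       i k []           = divides 0 refl
shiftedCoeff-∣ (c ∷ cs) i k (b∣c ∷ b∣cs) = ∣m∣n⇒∣m+n (∣m⇒∣m*n (i C k) b∣c) (shiftedCoeff-∣ cs (suc i) k b∣cs)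

-- Conversely, since the change of basis is unitriangular, divisibility of the
-- coefficients of degree at least i gives divisibility of all coordinates.
∣-shiftedCoeff : ∀ {b} cs i → (∀ k → i ≤ k → b ∣ shiftedCoeff cs i k) → All (b ∣_) cs
∣-shiftedCoeff []       i divisible = []
∣-shiftedCoeff {b} (c ∷ cs) i divisible = b∣c ∷ b∣cs
  where
  beyond-i : ∀ k → i < k → shiftedCoeff (c ∷ cs) i k ≡ shiftedCoeff cs (suc i) k
  beyond-i k i<k = cong (_+ shiftedCoeff cs (suc i) k) (trans (cong (c *_) (k>n⇒nCk≡0 i<k)) (ℕP.*-zeroʳ c))
  b∣cs : All (b ∣_) cs
  b∣cs = ∣-shiftedCoeff cs (suc i) (λ k i<k → subst (b ∣_) (beyond-i k i<k) (divisible k (ℕP.<⇒≤ i<k)))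
  at-i : shiftedCoeff (c ∷ cs) i i ≡ shiftedCoeff cs (suc i) i + c
  at-i = trans (cong (λ x → c * x + shiftedCoeff cs (suc i) i) (nCn≡1 i))
               (trans (cong (_+ shiftedCoeff cs (suc i) i) (ℕP.*-identityʳ c)) (ℕP.+-comm c _))
  b∣c : b ∣ c
  b∣c = ∣m+n∣m⇒∣n (subst (b ∣_) at-i (divisible i ℕP.≤-refl)) (shiftedCoeff-∣ cs (suc i) i b∣cs)

shiftedCoeff-divide : ∀ b .{{_ : NonZero b}} cs i k → All (b ∣_) cs →
  shiftedCoeff (map (_/ b) cs) i k * b ≡ shiftedCoeff cs i k
shiftedCoeff-divide b []       i k []           = refl
shiftedCoeff-divide b (c ∷ cs) i k (b∣c ∷ b∣cs) = begin
  (c / b * (i C k) + shiftedCoeff (map (_/ b) cs) (suc i) k) * b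
    ≡⟨ distribute (c / b) (i C k) _ b ⟩
  c / b * b * (i C k) + shiftedCoeff (map (_/ b) cs) (suc i) k * b
    ≡⟨ cong₂ (λ x y → x * (i C k) + y) (m/n*n≡m b∣c) (shiftedCoeff-divide b cs (suc i) k b∣cs) ⟩
  c * (i C k) + shiftedCoeff cs (suc i) k ∎
  where
  distribute : ∀ x y s b → (x * y + s) * b ≡ x * b * y + s * b
  distribute = ℕSolver.solve-∀

-- (x+1)-positivity passes from f to g when f·a = g·b coefficientwise with b ≠ 0:
-- the coordinates of g are those of f times a/b, which are natural numbers.
positivity-transfer : ∀ (f g : ℕ → ℕ) a b .{{_ : NonZero b}} → (∀ k → f k * a ≡ g k * b) →
  XPlus1Positive (λ k → + f k) → XPlus1Positive (λ k → + g k)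
positivity-transfer f g a b fa≡gb (cs , f≡) = map (_/ b) scaled , λ k →
  cong +_ (ℕP.*-cancelʳ-≡ (g k) _ b (trans (sym (coeff k)) (sym (shiftedCoeff-divide b scaled 0 k divisible))))
  where
  scaled = map (_* a) cs
  coeff : ∀ k → shiftedCoeff scaled 0 k ≡ g k * b
  coeff k = begin
    shiftedCoeff scaled 0 k    ≡⟨ shiftedCoeff-scale a cs 0 k ⟩
    shiftedCoeff cs 0 k * a    ≡⟨ cong (_* a) (sym (ℤP.+-injective (f≡ k))) ⟩
    f k * a                    ≡⟨ fa≡gb k ⟩
    g k * b                    ∎
  divisible : All (b ∣_) scaled
  divisible = ∣-shiftedCoeff scaled 0 (λ k _ → divides (g k) (coeff k))

proposition3p14 : ∀ (r l u d : ℕ) →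
    (∀ k → (F r l u d · (+ ((r + l) ! * (u + d) !))) k
         ≡ (F r u l d · (+ ((r + u) ! * (l + d) !))) k)
    × (XPlus1Positive (F r l u d) ⇔ XPlus1Positive (F r u l d))
proposition3p14 r l u d = scaled-equality , mk⇔
  (positivity-transfer (coeffF r l u d) (coeffF r u l d) A B {{ℕP._!*_!≢0 (r + u) (l + d)}} symmetry)
  (positivity-transfer (coeffF r u l d) (coeffF r l u d) B A {{ℕP._!*_!≢0 (r + l) (u + d)}} (λ k → sym (symmetry k)))
  where
  A = (r + l) ! * (u + d) !
  B = (r + u) ! * (l + d) !
  symmetry : ∀ k → coeffF r l u d k * A ≡ coeffF r u l d k * B
  symmetry = coeffF-symmetry r l u d
  scaled-equality : ∀ k → (F r l u d · (+ A)) k ≡ (F r u l d · (+ B)) k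
  scaled-equality k =
    trans (sym (ℤP.pos-* (coeffF r l u d k) A)) (trans (cong +_ (symmetry k)) (ℤP.pos-* (coeffF r u l d k) B))
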